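{- Let $1 \leq i \neq j \leq n$ and $\mathcal F \subset \binom{[n]}{k}$. Then $$\left|\mathcal T^{(2)}(\mathcal F)\right| \leq \left|\mathcal T^{(2)}(S_{ij}(\mathcal F))\right|.$$
   Context: $\binom{[n]}{k}$ is the collection of $k$-element subsets of $[n]=\{1,\dots,n\}$. For a family $\mathcal F$, $\mathcal T^{(2)}(\mathcal F) = \{H \in \binom{[n]}{2} : H \cap F \neq \emptyset \text{ for all } F \in \mathcal F\}$. The shifting operator is $S_{ij}(\mathcal F) = \{S_{ij}(F) : F \in \mathcal F\}$, where $S_{ij}(F) = F' := (F \setminus \{j\}) \cup \{i\}$ if $i \notin F$, $j \in F$ and $F' \notin \mathcal F$, and $S_{ij}(F) = F$ otherwise. -}

module Defs where

open import Data.Nat using (ℕ; zero; suc)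
open import Data.Bool using (Bool; true; false)
import Data.Bool.Properties as BoolP
open import Data.Fin using (Fin)
open import Data.Fin.Subset using (Subset; _∈_; _∉_; _∩_; _∪_; _-_; ⁅_⁆; ∣_∣; Nonempty)
open import Data.Fin.Subset.Properties using (_∈?_; nonempty?)
open import Data.Vec using (Vec; []; _∷_)
open import Data.Vec.Properties using (≡-dec)
open import Data.List using (List; []; _∷_; _++_; map; filter; length)
open import Data.List.Relation.Unary.All using (All; all?)
open import Data.List.Relation.Unary.Any using (any?)
open import Data.List.Membership.Propositional using () renaming (_∈_ to _∈ₗ_)
open import Data.Product using (_×_)
open import Relation.Nullary using (Dec; yes; no; ¬_)
open import Relation.Nullary.Decidable using (_×-dec_)
open import Relation.Binary.PropositionalEquality using (_≡_)
open import Relation.Binary.Definitions using (DecidableEquality)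
import Data.Nat.Properties as NatP

_≟ₛ_ : ∀ {n} → DecidableEquality (Subset n)
_≟ₛ_ = ≡-dec BoolP._≟_

-- A family of subsets of [n] is a finite list of subsets (distinctness is
-- imposed as a hypothesis where needed).
Family : ℕ → Set
Family n = List (Subset n)

_∈?ₗ_ : ∀ {n} (G : Subset n) (𝓕 : Family n) → Dec (G ∈ₗ 𝓕)
G ∈?ₗ 𝓕 = any? (G ≟ₛ_) 𝓕

allSubsets : ∀ n → List (Subset n)
allSubsets zero    = [] ∷ []
allSubsets (suc n) = map (false ∷_) (allSubsets n) ++ map (true ∷_) (allSubsets n)

HitsAll : ∀ {n} → Subset n → Family n → Set
HitsAll H 𝓕 = All (λ F → Nonempty (H ∩ F)) 𝓕

T2 : ∀ {n} → Family n → List (Subset n)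
T2 {n} 𝓕 = filter (λ H → (∣ H ∣ NatP.≟ 2) ×-dec all? (λ F → nonempty? (H ∩ F)) 𝓕) (allSubsets n)

shiftSet : ∀ {n} → Fin n → Fin n → Family n → Subset n → Subset n
shiftSet i j 𝓕 F with i ∈? F | j ∈? F
... | yes _ | _     = F
... | no _  | no _  = F
... | no _  | yes _ with ((F - j) ∪ ⁅ i ⁆) ∈?ₗ 𝓕
...   | yes _ = F
...   | no _  = (F - j) ∪ ⁅ i ⁆

shift : ∀ {n} → Fin n → Fin n → Family n → Family n
shift i j 𝓕 = map (shiftSet i j 𝓕) 𝓕

-- S_ij maps T²(𝓕), shifted as a family in its own right, injectively into T²(S_ij(𝓕)).
-- Shifting is injective on every family and preserves sizes; the point is that it also
-- preserves cross-intersection of two families. If H is moved but F is not, then F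
-- contains i, or misses j (so a common point of H and F survives in S_ij(H)), or F is
-- kept because S_ij(F) ∈ 𝓕: then H meets S_ij(F) at a point other than i (as i ∉ H),
-- and that point lies in both F and S_ij(H).
module Submission where

open import Defs
open import Data.Nat using (ℕ; _≤_; suc; z≤n; s≤s)
import Data.Nat.Properties as ℕ
open import Data.Fin using (Fin) renaming (_≟_ to _≟ᶠ_)
open import Data.Fin.Subset using (Subset; ∣_∣; _∈_; _∉_; _∩_; _∪_; _-_; _─_; ⁅_⁆; Nonempty; _⊆_)
open import Data.Fin.Subset.Properties
  using (x∈p∩q⁺; x∈p∩q⁻; x∈p∪q⁺; x∈p∪q⁻; x∈⁅x⁆; x∈⁅y⁆⇒x≡y; x∉⁅y⁆⇒x≢y; _∈?_; nonempty?; p─q⊆p; x∈p∧x≢y⇒x∈p-y; ⊆-antisym; ∪-identityʳ; p─⊥≡p)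
open import Data.List using (List; length; []; _∷_; _++_; map)
open import Data.List.Properties using (length-map)
open import Data.List.Relation.Unary.All as All using (All; all?; [])
import Data.List.Relation.Unary.All.Properties as All
open import Data.List.Relation.Unary.Any using (here; there)
open import Data.List.Relation.Unary.Unique.Propositional using (Unique; []; _∷_)
import Data.List.Relation.Unary.Unique.Propositional.Properties as Unique
open import Data.List.Membership.Propositional using () renaming (_∈_ to _∈ₗ_; _∉_ to _∉ₗ_)
open import Data.List.Membership.Propositional.Properties using (∈-filter⁺; ∈-filter⁻; ∈-∃++; ∈-map⁺; ∈-map⁻; ∈-++⁺ˡ; ∈-++⁺ʳ; ∈-++⁻)
open import Data.List.Relation.Binary.Subset.Propositional using () renaming (_⊆_ to _⊆ₗ_)
open import Data.List.Relation.Binary.Permutation.Propositional.Properties using (↭-length) renaming (shift to ↭-shift)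
open import Data.Vec using ([]; _∷_)
open import Data.Vec.Base using (here; there)
open import Data.Vec.Properties using (∷-injectiveˡ; ∷-injectiveʳ)
open import Data.Bool using (true; false)
open import Data.Product using (∃; _×_; _,_; proj₁; proj₂)
open import Data.Sum using (_⊎_; inj₁; inj₂)
open import Function using (_∘_; flip)
open import Relation.Nullary using (Dec; ¬_; yes; no; contradiction)
open import Relation.Nullary.Decidable using (_×-dec_)
open import Relation.Binary.PropositionalEquality using (_≡_; _≢_; refl; sym; trans; cong; subst)

private
  variable
    n : ℕ

module _ {A : Set} where

  Unique∧⊆⇒length≤ : {xs ys : List A} → Unique xs → xs ⊆ₗ ys → length xs ≤ length ys
  Unique∧⊆⇒length≤ {[]}     _            _     = z≤n
  Unique∧⊆⇒length≤ {x ∷ xs} {ys} (x∉xs ∷ xs!) xs⊆ys with ∈-∃++ (xs⊆ys (here refl))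
  ... | as , bs , refl = subst (suc (length xs) ≤_) (sym (↭-length (↭-shift x as bs)))
                           (s≤s (Unique∧⊆⇒length≤ xs! xs⊆as++bs))
    where
    xs⊆as++bs : xs ⊆ₗ as ++ bs
    xs⊆as++bs {y} y∈xs with ∈-++⁻ as (xs⊆ys (there y∈xs))
    ... | inj₁ y∈as         = ∈-++⁺ˡ y∈as
    ... | inj₂ (here y≡x)   = contradiction (sym y≡x) (All.lookup x∉xs y∈xs)
    ... | inj₂ (there y∈bs) = ∈-++⁺ʳ as y∈bs

  map⁺-injectiveOn : {B : Set} {f : A → B} {xs : List A} →
                     (∀ {x y} → x ∈ₗ xs → y ∈ₗ xs → f x ≡ f y → x ≡ y) →
                     Unique xs → Unique (map f xs)
  map⁺-injectiveOn _   []           = []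
  map⁺-injectiveOn inj (x∉xs ∷ xs!) =
    All.map⁺ (All.tabulate λ y∈xs fx≡fy → All.lookup x∉xs y∈xs (inj (here refl) (there y∈xs) fx≡fy))
    ∷ map⁺-injectiveOn (λ x∈ y∈ → inj (there x∈) (there y∈)) xs!

Meets : Subset n → Subset n → Set
Meets A B = ∃ λ x → x ∈ A × x ∈ B

Nonempty∩⇒Meets : {A B : Subset n} → Nonempty (A ∩ B) → Meets A B
Nonempty∩⇒Meets {A = A} {B} (x , x∈A∩B) = x , x∈p∩q⁻ A B x∈A∩B

Meets⇒Nonempty∩ : {A B : Subset n} → Meets A B → Nonempty (A ∩ B)
Meets⇒Nonempty∩ (x , x∈A , x∈B) = x , x∈p∩q⁺ (x∈A , x∈B)

Meets-sym : {A B : Subset n} → Meets A B → Meets B A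
Meets-sym (x , x∈A , x∈B) = x , x∈B , x∈A

CrossIntersecting : Family n → Family n → Set
CrossIntersecting 𝒜 ℬ = ∀ {A B} → A ∈ₗ 𝒜 → B ∈ₗ ℬ → Meets A B

x∈p-y⇒x≢y : ∀ {x y : Fin n} {p} → x ∈ p - y → x ≢ y
x∈p-y⇒x≢y {y = y} {p} x∈p-y = x∉⁅y⁆⇒x≢y (x∈p─q⇒x∉q p ⁅ y ⁆ x∈p-y)
  where
  x∈p─q⇒x∉q : ∀ {m} {x : Fin m} (p q : Subset m) → x ∈ p ─ q → x ∉ q
  x∈p─q⇒x∉q {x = Fin.zero}  (_ ∷ p) (true  ∷ q) () _
  x∈p─q⇒x∉q {x = Fin.zero}  (_ ∷ p) (false ∷ q) _  ()
  x∈p─q⇒x∉q {x = Fin.suc x} (_ ∷ p) (_     ∷ q) (there x∈p─q) (there x∈q) = x∈p─q⇒x∉q p q x∈p─q x∈q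

x∉p⇒∣p∪⁅x⁆∣≡1+∣p∣ : ∀ (x : Fin n) p → x ∉ p → ∣ p ∪ ⁅ x ⁆ ∣ ≡ suc ∣ p ∣
x∉p⇒∣p∪⁅x⁆∣≡1+∣p∣ Fin.zero    (false ∷ p) _   = cong (λ q → suc ∣ q ∣) (∪-identityʳ p)
x∉p⇒∣p∪⁅x⁆∣≡1+∣p∣ Fin.zero    (true  ∷ p) x∉p = contradiction here x∉p
x∉p⇒∣p∪⁅x⁆∣≡1+∣p∣ (Fin.suc x) (false ∷ p) x∉p = x∉p⇒∣p∪⁅x⁆∣≡1+∣p∣ x p (x∉p ∘ there)
x∉p⇒∣p∪⁅x⁆∣≡1+∣p∣ (Fin.suc x) (true  ∷ p) x∉p = cong suc (x∉p⇒∣p∪⁅x⁆∣≡1+∣p∣ x p (x∉p ∘ there))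

x∈p⇒1+∣p-x∣≡∣p∣ : ∀ (x : Fin n) p → x ∈ p → suc ∣ p - x ∣ ≡ ∣ p ∣
x∈p⇒1+∣p-x∣≡∣p∣ Fin.zero    (true  ∷ p) _           = cong (λ q → suc ∣ q ∣) (p─⊥≡p p)
x∈p⇒1+∣p-x∣≡∣p∣ (Fin.suc x) (false ∷ p) (there x∈p) = x∈p⇒1+∣p-x∣≡∣p∣ x p x∈p
x∈p⇒1+∣p-x∣≡∣p∣ (Fin.suc x) (true  ∷ p) (there x∈p) = cong suc (x∈p⇒1+∣p-x∣≡∣p∣ x p x∈p)

move : Fin n → Fin n → Subset n → Subset n
move i j A = (A - j) ∪ ⁅ i ⁆

module _ (i j : Fin n) where

  ∈-move⁺ : ∀ {x A} → x ∈ A → x ≢ j → x ∈ move i j A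
  ∈-move⁺ x∈A x≢j = x∈p∪q⁺ (inj₁ (x∈p∧x≢y⇒x∈p-y x∈A x≢j))

  ∈-move⁻ : ∀ {x} A → x ∈ move i j A → (x ∈ A × x ≢ j) ⊎ x ≡ i
  ∈-move⁻ A x∈ with x∈p∪q⁻ (A - j) ⁅ i ⁆ x∈
  ... | inj₁ x∈A-j = inj₁ (p─q⊆p A ⁅ j ⁆ x∈A-j , x∈p-y⇒x≢y x∈A-j)
  ... | inj₂ x∈⁅i⁆ = inj₂ (x∈⁅y⁆⇒x≡y i x∈⁅i⁆)

  i∈move : ∀ A → i ∈ move i j A
  i∈move A = x∈p∪q⁺ (inj₂ (x∈⁅x⁆ i))

  ∣move∣ : ∀ {A} → i ∉ A → j ∈ A → ∣ move i j A ∣ ≡ ∣ A ∣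
  ∣move∣ {A} i∉A j∈A =
    trans (x∉p⇒∣p∪⁅x⁆∣≡1+∣p∣ i (A - j) (i∉A ∘ p─q⊆p A ⁅ j ⁆)) (x∈p⇒1+∣p-x∣≡∣p∣ j A j∈A)

  move≡move⇒⊆ : ∀ {A B} → move i j A ≡ move i j B → i ∉ A → j ∈ B → A ⊆ B
  move≡move⇒⊆ {A} {B} eq i∉A j∈B {x} x∈A with x ≟ᶠ j
  ... | yes refl = j∈B
  ... | no x≢j with ∈-move⁻ B (subst (x ∈_) eq (∈-move⁺ x∈A x≢j))
  ...   | inj₁ (x∈B , _) = x∈B
  ...   | inj₂ refl      = contradiction x∈A i∉A

  data Fixed (𝒜 : Family n) (A : Subset n) : Set where
    has-i   : i ∈ A → Fixed 𝒜 A
    lacks-j : j ∉ A → Fixed 𝒜 A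
    blocked : move i j A ∈ₗ 𝒜 → Fixed 𝒜 A

  data ShiftSetView (𝒜 : Family n) (A : Subset n) : Subset n → Set where
    fixed : Fixed 𝒜 A → ShiftSetView 𝒜 A A
    moved : i ∉ A → j ∈ A → move i j A ∉ₗ 𝒜 → ShiftSetView 𝒜 A (move i j A)

  shiftSet-view : ∀ 𝒜 A → ShiftSetView 𝒜 A (shiftSet i j 𝒜 A)
  shiftSet-view 𝒜 A with i ∈? A | j ∈? A
  ... | yes i∈A | _       = fixed (has-i i∈A)
  ... | no _    | no j∉A  = fixed (lacks-j j∉A)
  ... | no i∉A  | yes j∈A with move i j A ∈?ₗ 𝒜
  ...   | yes m∈𝒜 = fixed (blocked m∈𝒜)
  ...   | no m∉𝒜  = moved i∉A j∈A m∉𝒜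

  ∣shiftSet∣ : ∀ 𝒜 A → ∣ shiftSet i j 𝒜 A ∣ ≡ ∣ A ∣
  ∣shiftSet∣ 𝒜 A with shiftSet i j 𝒜 A | shiftSet-view 𝒜 A
  ... | _ | fixed _           = refl
  ... | _ | moved i∉A j∈A _ = ∣move∣ i∉A j∈A

  shiftSet-injectiveOn : ∀ {𝒜 A B} → A ∈ₗ 𝒜 → B ∈ₗ 𝒜 →
                         shiftSet i j 𝒜 A ≡ shiftSet i j 𝒜 B → A ≡ B
  shiftSet-injectiveOn {𝒜} {A} {B} A∈𝒜 B∈𝒜 = go (shiftSet-view 𝒜 A) (shiftSet-view 𝒜 B)
    where
    go : ∀ {SA SB} → ShiftSetView 𝒜 A SA → ShiftSetView 𝒜 B SB → SA ≡ SB → A ≡ B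
    go (fixed _)           (fixed _)           A≡B = A≡B
    go (fixed _)           (moved _ _ mB∉𝒜)    A≡mB = contradiction (subst (_∈ₗ 𝒜) A≡mB A∈𝒜) mB∉𝒜
    go (moved _ _ mA∉𝒜)    (fixed _)           mA≡B = contradiction (subst (_∈ₗ 𝒜) (sym mA≡B) B∈𝒜) mA∉𝒜
    go (moved i∉A j∈A _)   (moved i∉B j∈B _)   mA≡mB =
      ⊆-antisym (move≡move⇒⊆ mA≡mB i∉A j∈B) (move≡move⇒⊆ (sym mA≡mB) i∉B j∈A)

  shift-unique : ∀ {𝒜} → Unique 𝒜 → Unique (shift i j 𝒜)
  shift-unique = map⁺-injectiveOn shiftSet-injectiveOn

  move-meets-fixed : ∀ {ℬ A B} → i ∉ A → (∀ {B′} → B′ ∈ₗ ℬ → Meets A B′) → B ∈ₗ ℬ →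
                     Fixed ℬ B → Meets (move i j A) B
  move-meets-fixed {A = A} _ _ _ (has-i i∈B) = i , i∈move A , i∈B
  move-meets-fixed _ A-meets B∈ℬ (lacks-j j∉B) with A-meets B∈ℬ
  ... | x , x∈A , x∈B = x , ∈-move⁺ x∈A (λ { refl → j∉B x∈B }) , x∈B
  move-meets-fixed {B = B} i∉A A-meets _ (blocked mB∈ℬ) with A-meets mB∈ℬ
  ... | x , x∈A , x∈mB with ∈-move⁻ B x∈mB
  ...   | inj₁ (x∈B , x≢j) = x , ∈-move⁺ x∈A x≢j , x∈B
  ...   | inj₂ refl        = contradiction x∈A i∉A

  shiftSet-meets : ∀ {𝒜 ℬ A B} → CrossIntersecting 𝒜 ℬ → A ∈ₗ 𝒜 → B ∈ₗ ℬ →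
                   Meets (shiftSet i j 𝒜 A) (shiftSet i j ℬ B)
  shiftSet-meets {𝒜} {ℬ} {A} {B} cross A∈𝒜 B∈ℬ = go (shiftSet-view 𝒜 A) (shiftSet-view ℬ B)
    where
    go : ∀ {SA SB} → ShiftSetView 𝒜 A SA → ShiftSetView ℬ B SB → Meets SA SB
    go (fixed _)        (fixed _)        = cross A∈𝒜 B∈ℬ
    go (moved i∉A _ _)  (fixed B-fixed)  = move-meets-fixed i∉A (cross A∈𝒜) B∈ℬ B-fixed
    go (fixed A-fixed)  (moved i∉B _ _)  =
      Meets-sym (move-meets-fixed i∉B (Meets-sym ∘ flip cross B∈ℬ) A∈𝒜 A-fixed)
    go (moved _ _ _)    (moved _ _ _)    = i , i∈move A , i∈move B

  shift-crossIntersecting : ∀ {𝒜 ℬ} → CrossIntersecting 𝒜 ℬ →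
                            CrossIntersecting (shift i j 𝒜) (shift i j ℬ)
  shift-crossIntersecting {𝒜} {ℬ} cross SA∈ SB∈ with ∈-map⁻ (shiftSet i j 𝒜) SA∈ | ∈-map⁻ (shiftSet i j ℬ) SB∈
  ... | A , A∈𝒜 , refl | B , B∈ℬ , refl = shiftSet-meets cross A∈𝒜 B∈ℬ

∈-allSubsets : (H : Subset n) → H ∈ₗ allSubsets n
∈-allSubsets []          = here refl
∈-allSubsets (false ∷ H) = ∈-++⁺ˡ (∈-map⁺ (false ∷_) (∈-allSubsets H))
∈-allSubsets (true  ∷ H) = ∈-++⁺ʳ _ (∈-map⁺ (true ∷_) (∈-allSubsets H))

allSubsets-unique : ∀ n → Unique (allSubsets n)
allSubsets-unique ℕ.zero    = [] ∷ []
allSubsets-unique (suc n) =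
  Unique.++⁺ (Unique.map⁺ ∷-injectiveʳ (allSubsets-unique n))
             (Unique.map⁺ ∷-injectiveʳ (allSubsets-unique n))
             heads-differ
  where
  heads-differ : ∀ {H} → ¬ (H ∈ₗ map (false ∷_) (allSubsets n) × H ∈ₗ map (true ∷_) (allSubsets n))
  heads-differ (H∈₀ , H∈₁) with ∈-map⁻ (false ∷_) H∈₀ | ∈-map⁻ (true ∷_) H∈₁
  ... | _ , _ , refl | _ , _ , eq with ∷-injectiveˡ eq
  ... | ()

module _ (𝓕 : Family n) where

  private
    isTransversalPair? : (H : Subset n) → Dec (∣ H ∣ ≡ 2 × HitsAll H 𝓕)
    isTransversalPair? H = (∣ H ∣ ℕ.≟ 2) ×-dec all? (λ F → nonempty? (H ∩ F)) 𝓕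

  ∈-T2⁻ : ∀ {H} → H ∈ₗ T2 𝓕 → ∣ H ∣ ≡ 2 × HitsAll H 𝓕
  ∈-T2⁻ = proj₂ ∘ ∈-filter⁻ isTransversalPair? {xs = allSubsets n}

  ∈-T2⁺ : ∀ {H} → ∣ H ∣ ≡ 2 → HitsAll H 𝓕 → H ∈ₗ T2 𝓕
  ∈-T2⁺ {H} ∣H∣≡2 H-hits = ∈-filter⁺ isTransversalPair? (∈-allSubsets H) (∣H∣≡2 , H-hits)

  T2-unique : Unique (T2 𝓕)
  T2-unique = Unique.filter⁺ isTransversalPair? (allSubsets-unique n)

  T2-crossIntersecting : CrossIntersecting (T2 𝓕) 𝓕
  T2-crossIntersecting H∈T F∈𝓕 = Nonempty∩⇒Meets (All.lookup (proj₂ (∈-T2⁻ H∈T)) F∈𝓕)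

shift-T2⊆T2-shift : (i j : Fin n) (𝓕 : Family n) → shift i j (T2 𝓕) ⊆ₗ T2 (shift i j 𝓕)
shift-T2⊆T2-shift i j 𝓕 SH∈ with ∈-map⁻ (shiftSet i j (T2 𝓕)) SH∈
... | H , H∈T , refl = ∈-T2⁺ (shift i j 𝓕)
  (trans (∣shiftSet∣ i j (T2 𝓕) H) (proj₁ (∈-T2⁻ 𝓕 H∈T)))
  (All.tabulate (Meets⇒Nonempty∩ ∘ shift-crossIntersecting i j (T2-crossIntersecting 𝓕) SH∈))

-- None of i ≢ j, distinctness of 𝓕 or uniformity of its sizes is needed.
claim2p3 : (n k : ℕ) (i j : Fin n) → i ≢ j →
    (𝓕 : Family n) → Unique 𝓕 → All (λ F → ∣ F ∣ ≡ k) 𝓕 →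
    length (T2 𝓕) ≤ length (T2 (shift i j 𝓕))
claim2p3 n k i j _ 𝓕 _ _ = begin
  length (T2 𝓕)             ≡⟨ length-map (shiftSet i j (T2 𝓕)) (T2 𝓕) ⟨
  length (shift i j (T2 𝓕)) ≤⟨ Unique∧⊆⇒length≤ (shift-unique i j (T2-unique 𝓕)) (shift-T2⊆T2-shift i j 𝓕) ⟩
  length (T2 (shift i j 𝓕)) ∎
  where open ℕ.≤-Reasoning
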